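{- Let $\bar m=(m_j)_{j\in\omega}$ and $\bar n=(n_j)_{j\in\omega}$ be sequences of natural numbers, and suppose there is a finite-to-one function $f:\omega\to\omega$ with $\omega\setminus f[\omega]$ finite such that $m_{f(j)}$ divides $n_j$ for all but finitely many $j\in\omega$. Then $\mathfrak A_{\bar m}$ embeds into $\mathfrak A_{\bar n}$, and therefore $\mathrm{Th}_\exists(\mathfrak A_{\bar m})\subseteq\mathrm{Th}_\exists(\mathfrak A_{\bar n})$.
   Context: For a sequence $\bar n=(n_j)$, let $I_k=[\sum_{i<k}n_i,\sum_{i\le k}n_i)$ be consecutive intervals of $\mathbb N$; the rotary permutation $r_{\bar n}$ cyclically permutes each $I_k$ ($i\mapsto i+1$ except $\max I_k\mapsto\min I_k$). $\alpha_{\bar n}([A]_{\mathrm{Fin}})=[r_{\bar n}[A]]_{\mathrm{Fin}}$ and $\mathfrak A_{\bar n}=\langle\mathcal P(\mathbb N)/\mathrm{Fin},\alpha_{\bar n}\rangle$, a structure in the language of Boolean algebras with a unary function symbol. An embedding is an injective Boolean algebra homomorphism $\eta$ with $\eta\circ\alpha_{\bar m}=\alpha_{\bar n}\circ\eta$. $\mathrm{Th}_\exists$ is the existential theory. -}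

module Defs where

open import Data.Nat using (ℕ; zero; suc; _+_; _∸_; _≤_; _<_; _<?_; _≟_)
open import Data.Nat.Divisibility using (_∣_)
open import Data.Bool using (Bool; true; false; _∧_; _∨_; not; if_then_else_)
open import Data.Fin using (Fin)
open import Data.Product using (Σ; ∃; _×_)
open import Data.Sum using (_⊎_)
open import Data.Unit using (⊤)
open import Data.Empty using (⊥)
open import Relation.Nullary using (¬_; does)
open import Relation.Binary.PropositionalEquality using (_≡_)

Seq : Set
Seq = ℕ → ℕ

Positive : Seq → Set
Positive n = ∀ j → 1 ≤ n j

Subset : Set
Subset = ℕ → Bool

-- A =* B : equal modulo Fin (symmetric difference finite)
_=*_ : Subset → Subset → Set
A =* B = Σ ℕ λ N → ∀ i → N ≤ i → A i ≡ B i

_∪_ _∩_ : Subset → Subset → Subset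
(A ∪ B) i = A i ∨ B i
(A ∩ B) i = A i ∧ B i

compl : Subset → Subset
compl A i = not (A i)

∅ full : Subset
∅ _ = false
full _ = true

-- Intervals I_k = [s_k, s_k + n k) with
-- s_0 = 0, s_{k+1} = s_k + n k.  We walk through the intervals starting
-- at interval k with left endpoint s; fuel (suc i) suffices when n is
-- positive, since then the interval containing i has index ≤ i.

rotFrom : Seq → ℕ → ℕ → ℕ → ℕ → ℕ
rotFrom n zero k s i = i
rotFrom n (suc fuel) k s i =
  if does (i <? s + n k)
  then (if does (suc i ≟ s + n k) then s else suc i)
  else rotFrom n fuel (suc k) (s + n k) i

-- r_n̄ : i ↦ i+1, except max I_k ↦ min I_k
rot : Seq → ℕ → ℕ
rot n i = rotFrom n (suc i) 0 0 i

-- inverse of r_n̄ : i ↦ i-1, except min I_k ↦ max I_k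
rotInvFrom : Seq → ℕ → ℕ → ℕ → ℕ → ℕ
rotInvFrom n zero k s i = i
rotInvFrom n (suc fuel) k s i =
  if does (i <? s + n k)
  then (if does (i ≟ s) then s + n k ∸ 1 else i ∸ 1)
  else rotInvFrom n fuel (suc k) (s + n k) i

rotInv : Seq → ℕ → ℕ
rotInv n i = rotInvFrom n (suc i) 0 0 i

image : Seq → Subset → Subset
image n A i = A (rotInv n i)

α : Seq → Subset → Subset
α n A = image n A

-- Embeddings 𝔄_m̄ → 𝔄_n̄, on representatives: a map respecting =*,
-- a Boolean algebra homomorphism modulo Fin, injective on classes,
-- commuting with α.

record Embedding (m n : Seq) : Set where
  field
    η        : Subset → Subset
    η-cong   : ∀ A B → A =* B → η A =* η B
    η-∪      : ∀ A B → η (A ∪ B) =* (η A ∪ η B)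
    η-∩      : ∀ A B → η (A ∩ B) =* (η A ∩ η B)
    η-compl  : ∀ A → η (compl A) =* compl (η A)
    η-∅      : η ∅ =* ∅
    η-full   : η full =* full
    η-inj    : ∀ A B → η A =* η B → A =* B
    η-α      : ∀ A → η (α m A) =* α n (η A)

-- Existential sentences in the language {∪, ∩, compl, 0, 1, α}
-- (with equality), in prenex form ∃x₁…∃x_k φ, φ quantifier-free.

data Term (k : ℕ) : Set where
  var     : Fin k → Term k
  _⊔_ _⊓_ : Term k → Term k → Term k
  cmp     : Term k → Term k
  zero₀ one₁ : Term k
  fα      : Term k → Term k

data QF (k : ℕ) : Set where
  _≐_       : Term k → Term k → QF k
  tt ff     : QF k
  neg       : QF k → QF k
  _and_ _or_ : QF k → QF k → QF k

evalT : ∀ {k} → Seq → (Fin k → Subset) → Term k → Subset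
evalT m ρ (var x)   = ρ x
evalT m ρ (t ⊔ u)   = evalT m ρ t ∪ evalT m ρ u
evalT m ρ (t ⊓ u)   = evalT m ρ t ∩ evalT m ρ u
evalT m ρ (cmp t)   = compl (evalT m ρ t)
evalT m ρ zero₀     = ∅
evalT m ρ one₁      = full
evalT m ρ (fα t)    = α m (evalT m ρ t)

Sat : ∀ {k} → Seq → (Fin k → Subset) → QF k → Set
Sat m ρ (t ≐ u)   = evalT m ρ t =* evalT m ρ u
Sat m ρ tt        = ⊤
Sat m ρ ff        = ⊥
Sat m ρ (neg φ)   = ¬ Sat m ρ φ
Sat m ρ (φ and ψ) = Sat m ρ φ × Sat m ρ ψ
Sat m ρ (φ or ψ)  = Sat m ρ φ ⊎ Sat m ρ ψ

SatEx : Seq → (k : ℕ) → QF k → Set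
SatEx m k φ = Σ (Fin k → Subset) λ ρ → Sat m ρ φ

ThEx⊆ : Seq → Seq → Set
ThEx⊆ m n = ∀ k (φ : QF k) → SatEx m k φ → SatEx n k φ

FiniteToOne : (ℕ → ℕ) → Set
FiniteToOne f = ∀ k → Σ ℕ λ b → ∀ j → f j ≡ k → j < b

CofiniteRange : (ℕ → ℕ) → Set
CofiniteRange f = Σ ℕ λ K → ∀ k → K ≤ k → Σ ℕ λ j → f j ≡ k

EventuallyDivides : Seq → Seq → (ℕ → ℕ) → Set
EventuallyDivides m n f = Σ ℕ λ J → ∀ j → J ≤ j → m (f j) ∣ n j

-- Let I_j and J_k be the intervals of n̄ and m̄. The embedding η fills I_j with
-- copies of the pattern A ∩ J_{f(j)}, repeated with period m_{f(j)} (empty for the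
-- finitely many j where the divisibility may fail). Because m_{f(j)} divides
-- n_j = |I_j|, rotating I_j by one step and reducing offsets modulo m_{f(j)}
-- is the same as rotating J_{f(j)} by one step, so η commutes with the rotary
-- automorphisms. Finite-to-one-ness of f makes η respect equality modulo Fin,
-- and cofiniteness of its range makes η injective modulo Fin, since almost
-- every block J_k is copied verbatim into some I_j. An embedding maps witnesses
-- of an existential sentence to witnesses, which gives the inclusion of theories.

module Submission where

open import Defs
open import Data.Bool using (Bool; true; false; _∧_; _∨_; not; if_then_else_)
open import Data.Fin using (Fin)
open import Data.Nat.Base
open import Data.Nat.DivMod
open import Data.Nat.Divisibility using (_∣_; ∣⇒≤; n∣m⇒m%n≡0)
open import Data.Nat.Properties
open import Data.Product using (_×_; _,_; ∃; proj₁; proj₂)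
open import Data.Sum using (inj₁; inj₂)
open import Function.Base using (_∘_)
open import Relation.Binary.Definitions using (tri<; tri≈; tri>)
open import Relation.Binary.PropositionalEquality
open import Relation.Nullary using (yes; no; does; contradiction)
open import Relation.Nullary.Decidable using (dec-true; dec-false)

cycPred : ℕ → ℕ → ℕ
cycPred N zero    = N ∸ 1
cycPred N (suc t) = t

cycPred< : ∀ {N t} → t < N → cycPred N t < N
cycPred< {suc N} {zero}  _   = n<1+n N
cycPred< {N}     {suc t} t<N = <-trans (n<1+n t) t<N

cycPred≡[t+N∸1]%N : ∀ {N t} .{{_ : NonZero N}} → t < N → cycPred N t ≡ (t + (N ∸ 1)) % N
cycPred≡[t+N∸1]%N {suc N} {zero}  _   = sym (m<n⇒m%n≡m (n<1+n N))
cycPred≡[t+N∸1]%N {suc N} {suc t} t<N = begin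
  t                   ≡⟨ m<n⇒m%n≡m (<-trans (n<1+n t) t<N) ⟨
  t % suc N           ≡⟨ [m+n]%n≡m%n t (suc N) ⟨
  (t + suc N) % suc N ≡⟨ cong (_% suc N) (+-suc t N) ⟩
  (suc t + N) % suc N ∎
  where open ≡-Reasoning

m∣n⇒[n∸1]%m≡m∸1 : ∀ M N .{{_ : NonZero M}} .{{_ : NonZero N}} → M ∣ N → (N ∸ 1) % M ≡ M ∸ 1
m∣n⇒[n∸1]%m≡m∸1 M (suc N) M∣N = %-pred-≡0 (n∣m⇒m%n≡0 (suc N) M M∣N)

cycPred-% : ∀ {M N t} .{{_ : NonZero M}} .{{_ : NonZero N}} → M ∣ N → t < N →
            cycPred N t % M ≡ cycPred M (t % M)
cycPred-% {M} {N} {t} M∣N t<N = begin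
  cycPred N t % M                     ≡⟨ cong (_% M) (cycPred≡[t+N∸1]%N t<N) ⟩
  (t + (N ∸ 1)) % N % M               ≡⟨ m∣n⇒o%n%m≡o%m M N _ M∣N ⟩
  (t + (N ∸ 1)) % M                   ≡⟨ %-distribˡ-+ t (N ∸ 1) M ⟩
  (t % M + (N ∸ 1) % M) % M           ≡⟨ cong (λ r → (t % M + r) % M) (m∣n⇒[n∸1]%m≡m∸1 M N M∣N) ⟩
  (t % M + (M ∸ 1)) % M               ≡⟨ cycPred≡[t+N∸1]%N (m%n<n t M) ⟨
  cycPred M (t % M)                   ∎
  where open ≡-Reasoning

-- The branch of rotInvFrom taken at a point s + t of the interval with left end s and length N.
shifted-cycPred : ∀ s {N} t → 1 ≤ N →
                  (if does (s + t ≟ s) then s + N ∸ 1 else s + t ∸ 1) ≡ s + cycPred N t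
shifted-cycPred s zero    1≤N
  rewrite dec-true (s + 0 ≟ s) (+-identityʳ s) = +-∸-assoc s 1≤N
shifted-cycPred s (suc t) _
  rewrite dec-false (s + suc t ≟ s) (m+1+n≢m s) = cong pred (+-suc s t)

partialSum : Seq → ℕ → ℕ
partialSum n zero    = 0
partialSum n (suc k) = partialSum n k + n k

module _ (n : Seq) where

  partialSum-mono-≤ : ∀ {a b} → a ≤ b → partialSum n a ≤ partialSum n b
  partialSum-mono-≤ {b = zero}  z≤n = ≤-refl
  partialSum-mono-≤ {b = suc b} a≤1+b with m≤n⇒m<n∨m≡n a≤1+b
  ... | inj₁ a<1+b = ≤-trans (partialSum-mono-≤ (s≤s⁻¹ a<1+b)) (m≤m+n _ (n b))
  ... | inj₂ refl  = ≤-refl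

  partialSum-term : ∀ {k K} → k < K → n k ≤ partialSum n K
  partialSum-term {k} k<K = ≤-trans (m≤n+m (n k) (partialSum n k)) (partialSum-mono-≤ k<K)

  partialSum-≥ : Positive n → ∀ k → k ≤ partialSum n k
  partialSum-≥ pn zero    = z≤n
  partialSum-≥ pn (suc k) = subst (_≤ partialSum n k + n k) (+-comm k 1) (+-mono-≤ (partialSum-≥ pn k) (pn k))

  -- I_k = [partialSum n k, partialSum n (suc k)); a point of I_k is partialSum n k + t with t < n k.
  record Block (i : ℕ) : Set where
    constructor block
    field
      index      : ℕ
      offset     : ℕ
      offset<    : offset < n index
      decomposes : partialSum n index + offset ≡ i

  decompose : Positive n → ∀ i → Block i
  decompose pn zero = block 0 0 (pn 0) refl
  decompose pn (suc i) with decompose pn i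
  ... | block k t t< refl with suc t <? n k
  ...   | yes 1+t< = block k (suc t) 1+t< (+-suc (partialSum n k) t)
  ...   | no  1+t≮ = block (suc k) 0 (pn (suc k)) (begin
    partialSum n k + n k + 0   ≡⟨ +-identityʳ _ ⟩
    partialSum n k + n k       ≡⟨ cong (partialSum n k +_) (≤-antisym t< (≮⇒≥ 1+t≮)) ⟨
    partialSum n k + suc t     ≡⟨ +-suc (partialSum n k) t ⟩
    suc (partialSum n k + t)   ∎)
    where open ≡-Reasoning

  block-ordered : ∀ {k k′ t t′} → k < k′ → t < n k →
                  partialSum n k + t < partialSum n k′ + t′
  block-ordered {k} {k′} {t} {t′} k<k′ t< = begin-strict
    partialSum n k + t     <⟨ +-monoʳ-< (partialSum n k) t< ⟩
    partialSum n (suc k)   ≤⟨ partialSum-mono-≤ k<k′ ⟩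
    partialSum n k′        ≤⟨ m≤m+n _ t′ ⟩
    partialSum n k′ + t′   ∎
    where open ≤-Reasoning

  block-unique : ∀ {k k′ t t′} → t < n k → t′ < n k′ →
                 partialSum n k + t ≡ partialSum n k′ + t′ → k ≡ k′ × t ≡ t′
  block-unique {k} {k′} t< t′< eq with <-cmp k k′
  ... | tri< k<k′ _ _ = contradiction eq (<⇒≢ (block-ordered k<k′ t<))
  ... | tri> _ _ k′<k = contradiction (sym eq) (<⇒≢ (block-ordered k′<k t′<))
  ... | tri≈ _ refl _ = refl , +-cancelˡ-≡ (partialSum n k) _ _ eq

  blockwise-=* : Positive n → ∀ {X Y : Subset} T →
                 (∀ k t → T ≤ k → t < n k → X (partialSum n k + t) ≡ Y (partialSum n k + t)) →
                 X =* Y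
  blockwise-=* pn {X} {Y} T h = partialSum n T , λ i T≤i → go i T≤i (decompose pn i)
    where
    go : ∀ i → partialSum n T ≤ i → Block i → X i ≡ Y i
    go i T≤i (block k t t< refl) = h k t (≮⇒≥ λ k<T → <⇒≱ (block-ordered k<T t<) (≤-trans (≤-reflexive (+-identityʳ _)) T≤i)) t<

  fromBlocks : Positive n → (ℕ → ℕ → Bool) → Subset
  fromBlocks pn g i = g (Block.index b) (Block.offset b)
    where b = decompose pn i

  fromBlocks-block : ∀ (pn : Positive n) g {k t} → t < n k → fromBlocks pn g (partialSum n k + t) ≡ g k t
  fromBlocks-block pn g {k} {t} t< = atBlock (decompose pn (partialSum n k + t))
    where
    atBlock : (b : Block (partialSum n k + t)) → g (Block.index b) (Block.offset b) ≡ g k t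
    atBlock (block k′ t′ t′< eq) with block-unique t′< t< eq
    ... | refl , refl = refl

  rotInvFrom-block : Positive n → ∀ F k₀ {k t} → k₀ ≤ k → k < k₀ + F → t < n k →
                     rotInvFrom n F k₀ (partialSum n k₀) (partialSum n k + t) ≡ partialSum n k + cycPred (n k) t
  rotInvFrom-block pn zero    k₀ k₀≤k k<k₀+0 _ = contradiction (subst (_ <_) (+-identityʳ k₀) k<k₀+0) (≤⇒≯ k₀≤k)
  rotInvFrom-block pn (suc F) k₀ {k} {t} k₀≤k k<k₀+1+F t< with m≤n⇒m<n∨m≡n k₀≤k
  ... | inj₂ refl
    rewrite dec-true (partialSum n k + t <? partialSum n k + n k) (+-monoʳ-< (partialSum n k) t<)
    = shifted-cycPred (partialSum n k) t (pn k)
  ... | inj₁ k₀<k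
    rewrite dec-false (partialSum n k + t <? partialSum n k₀ + n k₀)
                      (≤⇒≯ (≤-trans (partialSum-mono-≤ k₀<k) (m≤m+n _ t)))
    = rotInvFrom-block pn F (suc k₀) k₀<k (subst (k <_) (+-suc k₀ F) k<k₀+1+F) t<

  rotInv-block : Positive n → ∀ {k t} → t < n k → rotInv n (partialSum n k + t) ≡ partialSum n k + cycPred (n k) t
  rotInv-block pn {k} {t} t< =
    rotInvFrom-block pn (suc (partialSum n k + t)) 0 z≤n (s≤s (≤-trans (partialSum-≥ pn k) (m≤m+n _ t))) t<

  α-block : Positive n → ∀ A {k t} → t < n k → α n A (partialSum n k + t) ≡ A (partialSum n k + cycPred (n k) t)
  α-block pn A t< = cong A (rotInv-block pn t<)

=*-refl : ∀ {A} → A =* A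
=*-refl = 0 , λ _ _ → refl

=*-sym : ∀ {A B} → A =* B → B =* A
=*-sym (N , h) = N , λ i N≤i → sym (h i N≤i)

=*-trans : ∀ {A B C} → A =* B → B =* C → A =* C
=*-trans (N , h) (M , g) = N + M , λ i N+M≤i →
  trans (h i (≤-trans (m≤m+n N M) N+M≤i)) (g i (≤-trans (m≤n+m M N) N+M≤i))

pointwise-=* : ∀ (_·_ : Bool → Bool → Bool) {A A′ B B′} → A =* A′ → B =* B′ →
               (λ i → A i · B i) =* (λ i → A′ i · B′ i)
pointwise-=* _·_ (N , h) (M , g) = N + M , λ i N+M≤i →
  cong₂ _·_ (h i (≤-trans (m≤m+n N M) N+M≤i)) (g i (≤-trans (m≤n+m M N) N+M≤i))

compl-cong : ∀ {A B} → A =* B → compl A =* compl B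
compl-cong (N , h) = N , λ i N≤i → cong not (h i N≤i)

α-cong : ∀ n → Positive n → ∀ {A B} → A =* B → α n A =* α n B
α-cong n pn {A} {B} (N , h) = blockwise-=* n pn N λ k t N≤k t< → begin
  α n A (partialSum n k + t)              ≡⟨ α-block n pn A t< ⟩
  A (partialSum n k + cycPred (n k) t)    ≡⟨ h _ (≤-trans N≤k (≤-trans (partialSum-≥ n pn k) (m≤m+n _ _))) ⟩
  B (partialSum n k + cycPred (n k) t)    ≡⟨ α-block n pn B t< ⟨
  α n B (partialSum n k + t)              ∎
  where open ≡-Reasoning

module _ {m n : Seq} (pn : Positive n) (E : Embedding m n) where
  open Embedding E

  η-evalT : ∀ {k} (ρ : Fin k → Subset) t → evalT n (η ∘ ρ) t =* η (evalT m ρ t)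
  η-evalT ρ (var x) = =*-refl
  η-evalT ρ (t ⊔ u) = =*-trans (pointwise-=* _∨_ (η-evalT ρ t) (η-evalT ρ u)) (=*-sym (η-∪ _ _))
  η-evalT ρ (t ⊓ u) = =*-trans (pointwise-=* _∧_ (η-evalT ρ t) (η-evalT ρ u)) (=*-sym (η-∩ _ _))
  η-evalT ρ (cmp t) = =*-trans (compl-cong (η-evalT ρ t)) (=*-sym (η-compl _))
  η-evalT ρ zero₀   = =*-sym η-∅
  η-evalT ρ one₁    = =*-sym η-full
  η-evalT ρ (fα t)  = =*-trans (α-cong n pn (η-evalT ρ t)) (=*-sym (η-α _))

  η-Sat : ∀ {k} (ρ : Fin k → Subset) φ → Sat m ρ φ → Sat n (η ∘ ρ) φ
  η-Sat⁻ : ∀ {k} (ρ : Fin k → Subset) φ → Sat n (η ∘ ρ) φ → Sat m ρ φ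

  η-Sat ρ (t ≐ u)   s          = =*-trans (η-evalT ρ t) (=*-trans (η-cong _ _ s) (=*-sym (η-evalT ρ u)))
  η-Sat ρ tt        s          = s
  η-Sat ρ ff        ()
  η-Sat ρ (neg φ)   ¬s s′      = ¬s (η-Sat⁻ ρ φ s′)
  η-Sat ρ (φ and ψ) (s , s′)   = η-Sat ρ φ s , η-Sat ρ ψ s′
  η-Sat ρ (φ or ψ)  (inj₁ s)   = inj₁ (η-Sat ρ φ s)
  η-Sat ρ (φ or ψ)  (inj₂ s)   = inj₂ (η-Sat ρ ψ s)

  η-Sat⁻ ρ (t ≐ u)   s         = η-inj _ _ (=*-trans (=*-sym (η-evalT ρ t)) (=*-trans s (η-evalT ρ u)))
  η-Sat⁻ ρ tt        s         = s
  η-Sat⁻ ρ ff        ()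
  η-Sat⁻ ρ (neg φ)   ¬s s′     = ¬s (η-Sat ρ φ s′)
  η-Sat⁻ ρ (φ and ψ) (s , s′)  = η-Sat⁻ ρ φ s , η-Sat⁻ ρ ψ s′
  η-Sat⁻ ρ (φ or ψ)  (inj₁ s)  = inj₁ (η-Sat⁻ ρ φ s)
  η-Sat⁻ ρ (φ or ψ)  (inj₂ s)  = inj₂ (η-Sat⁻ ρ ψ s)

  embedding⇒ThEx⊆ : ThEx⊆ m n
  embedding⇒ThEx⊆ k φ (ρ , s) = η ∘ ρ , η-Sat ρ φ s

finiteToOne⇒large-argument⇒large-value : ∀ {f} → FiniteToOne f → ∀ N → ∃ λ K → ∀ j → K ≤ j → N ≤ f j
finiteToOne⇒large-argument⇒large-value {f} fto N = K , λ j K≤j → ≮⇒≥ λ fj<N →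
  <⇒≱ (proj₂ (fto (f j)) j refl) (≤-trans (partialSum-term bound fj<N) K≤j)
  where
  bound : Seq
  bound k = proj₁ (fto k)
  K : ℕ
  K = partialSum bound N

large-value⇒large-argument : ∀ (f : ℕ → ℕ) L → ∃ λ K → ∀ j → K ≤ f j → L ≤ j
large-value⇒large-argument f L = K , λ j K≤fj → ≮⇒≥ λ j<L →
  <⇒≱ (n<1+n (f j)) (≤-trans (partialSum-term (suc ∘ f) j<L) K≤fj)
  where
  K : ℕ
  K = partialSum (suc ∘ f) L

module BlockCopy {m n : Seq} (pm : Positive m) (pn : Positive n) (f : ℕ → ℕ)
                 (J₀ : ℕ) (m∣n : ∀ j → J₀ ≤ j → m (f j) ∣ n j) where

  instance
    m-nonZero : ∀ {k} → NonZero (m k)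
    m-nonZero = >-nonZero (pm _)
    n-nonZero : ∀ {k} → NonZero (n k)
    n-nonZero = >-nonZero (pn _)

  ηBlock : Subset → ℕ → ℕ → Bool
  ηBlock A j t with J₀ ≤? j
  ... | yes _ = A (partialSum m (f j) + t % m (f j))
  ... | no  _ = false

  η : Subset → Subset
  η A = fromBlocks n pn (ηBlock A)

  η-live : ∀ A {j t} → J₀ ≤ j → t < n j → η A (partialSum n j + t) ≡ A (partialSum m (f j) + t % m (f j))
  η-live A {j} {t} J₀≤j t< = trans (fromBlocks-block n pn (ηBlock A) t<) live
    where
    live : ηBlock A j t ≡ A (partialSum m (f j) + t % m (f j))
    live with J₀ ≤? j
    ... | yes _    = refl
    ... | no  J₀≰j = contradiction J₀≤j J₀≰j

  η-pointwise : ∀ (op : Bool → Bool → Bool) A B → η (λ i → op (A i) (B i)) =* (λ i → op (η A i) (η B i))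
  η-pointwise op A B = blockwise-=* n pn J₀ λ j t J₀≤j t< →
    trans (η-live _ J₀≤j t<) (sym (cong₂ op (η-live A J₀≤j t<) (η-live B J₀≤j t<)))

  η-compl : ∀ A → η (compl A) =* compl (η A)
  η-compl A = blockwise-=* n pn J₀ λ j t J₀≤j t< →
    trans (η-live (compl A) J₀≤j t<) (sym (cong not (η-live A J₀≤j t<)))

  η-const : ∀ b → η (λ _ → b) =* (λ _ → b)
  η-const b = blockwise-=* n pn J₀ λ j t J₀≤j t< → η-live (λ _ → b) J₀≤j t<

  η-α : ∀ A → η (α m A) =* α n (η A)
  η-α A = blockwise-=* n pn J₀ λ j t J₀≤j t< →
    let M = m (f j) ; s = partialSum m (f j) in begin
    η (α m A) (partialSum n j + t)                ≡⟨ η-live (α m A) J₀≤j t< ⟩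
    α m A (s + t % M)                             ≡⟨ α-block m pm A (m%n<n t M) ⟩
    A (s + cycPred M (t % M))                     ≡⟨ cong (λ r → A (s + r)) (cycPred-% (m∣n j J₀≤j) t<) ⟨
    A (s + cycPred (n j) t % M)                   ≡⟨ η-live A J₀≤j (cycPred< t<) ⟨
    η A (partialSum n j + cycPred (n j) t)        ≡⟨ α-block n pn (η A) t< ⟨
    α n (η A) (partialSum n j + t)                ∎
    where open ≡-Reasoning

  η-cong : FiniteToOne f → ∀ A B → A =* B → η A =* η B
  η-cong fto A B (N , h) = blockwise-=* n pn (J₀ + K) λ j t J₀+K≤j t< →
    let J₀≤j = ≤-trans (m≤m+n J₀ K) J₀+K≤j
        N≤fj = N≤f j (≤-trans (m≤n+m K J₀) J₀+K≤j) in begin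
    η A (partialSum n j + t)                        ≡⟨ η-live A J₀≤j t< ⟩
    A (partialSum m (f j) + t % m (f j))            ≡⟨ h _ (≤-trans N≤fj (≤-trans (partialSum-≥ m pm (f j)) (m≤m+n _ _))) ⟩
    B (partialSum m (f j) + t % m (f j))            ≡⟨ η-live B J₀≤j t< ⟨
    η B (partialSum n j + t)                        ∎
    where
    open ≡-Reasoning
    K : ℕ
    K = proj₁ (finiteToOne⇒large-argument⇒large-value fto N)
    N≤f : ∀ j → K ≤ j → N ≤ f j
    N≤f = proj₂ (finiteToOne⇒large-argument⇒large-value fto N)

  η-inj : CofiniteRange f → ∀ A B → η A =* η B → A =* B
  η-inj (Kf , onto) A B (N , h) = blockwise-=* m pm (Kf + K) λ k t Kf+K≤k t< →
    copy k t Kf+K≤k t< (onto k (≤-trans (m≤m+n Kf K) Kf+K≤k))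
    where
    open ≡-Reasoning
    K : ℕ
    K = proj₁ (large-value⇒large-argument f (J₀ + N))
    J₀+N≤ : ∀ j → K ≤ f j → J₀ + N ≤ j
    J₀+N≤ = proj₂ (large-value⇒large-argument f (J₀ + N))
    copy : ∀ k t → Kf + K ≤ k → t < m k → ∃ (λ j → f j ≡ k) →
           A (partialSum m k + t) ≡ B (partialSum m k + t)
    copy .(f j) t Kf+K≤fj t< (j , refl) = begin
      A (partialSum m (f j) + t)                ≡⟨ cong (λ r → A (partialSum m (f j) + r)) (m<n⇒m%n≡m t<) ⟨
      A (partialSum m (f j) + t % m (f j))      ≡⟨ η-live A J₀≤j t<n ⟨
      η A (partialSum n j + t)                  ≡⟨ h _ (≤-trans N≤j (≤-trans (partialSum-≥ n pn j) (m≤m+n _ _))) ⟩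
      η B (partialSum n j + t)                  ≡⟨ η-live B J₀≤j t<n ⟩
      B (partialSum m (f j) + t % m (f j))      ≡⟨ cong (λ r → B (partialSum m (f j) + r)) (m<n⇒m%n≡m t<) ⟩
      B (partialSum m (f j) + t)                ∎
      where
      J₀+N≤j = J₀+N≤ j (≤-trans (m≤n+m K Kf) Kf+K≤fj)
      J₀≤j = ≤-trans (m≤m+n J₀ N) J₀+N≤j
      N≤j = ≤-trans (m≤n+m N J₀) J₀+N≤j
      t<n : t < n j
      t<n = <-≤-trans t< (∣⇒≤ (m∣n j J₀≤j))

  embedding : FiniteToOne f → CofiniteRange f → Embedding m n
  embedding fto cof = record
    { η       = η
    ; η-cong  = η-cong fto
    ; η-∪     = η-pointwise _∨_
    ; η-∩     = η-pointwise _∧_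
    ; η-compl = η-compl
    ; η-∅     = η-const false
    ; η-full  = η-const true
    ; η-inj   = η-inj cof
    ; η-α     = η-α
    }

lemma5p2 : (m n : Seq) → Positive m → Positive n →
           (f : ℕ → ℕ) → FiniteToOne f → CofiniteRange f →
           EventuallyDivides m n f →
           Embedding m n × ThEx⊆ m n
lemma5p2 m n pm pn f fto cof (J₀ , m∣n) = E , embedding⇒ThEx⊆ pn E
  where
  E : Embedding m n
  E = BlockCopy.embedding pm pn f J₀ m∣n fto cof
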